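{- Let $\mathbf A$ be a Girard semilattice satisfying $x\le((x\to y)\wedge 1)\to y$ for all $x,y$. Then $\mathbf D(\mathbf A)=\langle D(\mathbf A),\to,\cup,\cap,\circ,\mathbf 1\rangle$ is a commutative residuated lattice.
   Context: A (pointed) Girard semilattice is an algebra $\langle A,\to,\wedge,1\rangle$ such that $\langle A,\wedge,1\rangle$ is a meet-semilattice with a constant $1$ (with $\le$ the semilattice order) and for all $a,b,c\in A$: (L1) $1\to a=a$; (L2) $a\to a\ge 1$; (L3) $(a\to b)\wedge(a\to c)=a\to(b\wedge c)$; (L4) $a\to b\le (c\to a)\to(c\to b)$; (L5) $a\to(b\to c)\le b\to(a\to c)$; (L6) if $a\to b\ge 1$ and $b\to a\ge 1$ then $a=b$. Let $\Gamma_{\mathbf A}$ be the set of semilattice filters of $\mathbf A$ (nonempty up-closed subsets closed under $\wedge$). A set $X\subseteq\Gamma_{\mathbf A}$ is hereditary if $F\in X$ and $F\subseteq G\in\Gamma_{\mathbf A}$ imply $G\in X$; $D(\mathbf A)$ is the set of hereditary subsets of $\Gamma_{\mathbf A}$, a lattice under inclusion with join $\cup$ and meet $\cap$. Put $\mathbf 1=\{F\in\Gamma_{\mathbf A}:1\in F\}$. Define $R(F,G,H)$ iff for all $a,b\in A$, $a\in F$ and $a\to b\in G$ imply $b\in H$. For $X,Y\in D(\mathbf A)$ let $X\circ Y=\{H:\exists F\in Y,\ \exists G\in X,\ R(F,G,H)\}$ and $X\to Y=\{H: \forall F,G\ (R(F,H,G)\ \&\ F\in X\Rightarrow G\in Y)\}$.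 A commutative residuated lattice is an algebra $\langle L,\to,\vee,\wedge,\cdot,1\rangle$ with $\langle L,\vee,\wedge\rangle$ a lattice, $\langle L,\cdot,1\rangle$ a commutative monoid and $x\cdot y\le z$ iff $x\le y\to z$. -}

module Defs where

open import Level using (Level; suc; _⊔_; Lift)
open import Data.Product using (Σ; ∃; _×_; _,_; proj₁; proj₂)
open import Data.Sum using (_⊎_)
open import Function using (_⇔_)
open import Relation.Binary.PropositionalEquality using (_≡_)
open import Relation.Binary.Core using (Rel)
open import Algebra.Core using (Op₂)
open import Algebra.Definitions using (Congruent₂)
open import Algebra.Structures using (IsCommutativeMonoid)
open import Algebra.Lattice.Structures using (IsLattice)

record GirardSemilattice (a : Level) : Set (suc a) where
  infixr 5 _⇒_
  infixr 6 _∧_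
  infix 4 _≤_
  field
    Carrier : Set a
    _⇒_     : Carrier → Carrier → Carrier
    _∧_     : Carrier → Carrier → Carrier
    one     : Carrier
    ∧-idem  : ∀ x → x ∧ x ≡ x
    ∧-comm  : ∀ x y → x ∧ y ≡ y ∧ x
    ∧-assoc : ∀ x y z → (x ∧ y) ∧ z ≡ x ∧ (y ∧ z)

  _≤_ : Carrier → Carrier → Set a
  x ≤ y = x ∧ y ≡ x

  field
    L1 : ∀ a → one ⇒ a ≡ a
    L2 : ∀ a → one ≤ a ⇒ a
    L3 : ∀ a b c → (a ⇒ b) ∧ (a ⇒ c) ≡ a ⇒ (b ∧ c)
    L4 : ∀ a b c → a ⇒ b ≤ (c ⇒ a) ⇒ (c ⇒ b)
    L5 : ∀ a b c → a ⇒ (b ⇒ c) ≤ b ⇒ (a ⇒ c)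
    L6 : ∀ a b → one ≤ a ⇒ b → one ≤ b ⇒ a → a ≡ b

-- Commutative residuated lattices, over a setoid equality _≈_.
-- Lattice order: x ≤ y iff x ∧ y ≈ x.

record IsCommResLattice {c ℓ : Level} {L : Set c} (_≈_ : Rel L ℓ)
         (_⇒_ _∨_ _∧_ _·_ : Op₂ L) (e : L) : Set (c ⊔ ℓ) where
  field
    isLattice           : IsLattice _≈_ _∨_ _∧_
    isCommutativeMonoid : IsCommutativeMonoid _≈_ _·_ e
    ⇒-cong              : Congruent₂ _≈_ _⇒_
    residuated          : ∀ x y z → (((x · y) ∧ z) ≈ (x · y)) ⇔ ((x ∧ (y ⇒ z)) ≈ x)

module Construction {a : Level} (𝐀 : GirardSemilattice a) where
  open GirardSemilattice 𝐀

  record IsFilter (F : Carrier → Set a) : Set a where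
    field
      nonempty : ∃ λ x → F x
      upclosed : ∀ {x y} → F x → x ≤ y → F y
      ∧-closed : ∀ {x y} → F x → F y → F (x ∧ y)

  Γ : Set (suc a)
  Γ = Σ (Carrier → Set a) IsFilter

  SubΓ : Set (suc (suc a))
  SubΓ = Γ → Set (suc a)

  _⊆_ : SubΓ → SubΓ → Set (suc a)
  X ⊆ Y = ∀ F → X F → Y F

  Hereditary : SubΓ → Set (suc a)
  Hereditary X = ∀ F G → X F → (∀ x → proj₁ F x → proj₁ G x) → X G

  R : Γ → Γ → Γ → Set a
  R F G H = ∀ x y → proj₁ F x → proj₁ G (x ⇒ y) → proj₁ H y

  𝟏 : SubΓ
  𝟏 F = Lift (suc a) (proj₁ F one)

  _∪_ : SubΓ → SubΓ → SubΓ
  (X ∪ Y) F = X F ⊎ Y F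

  _∩_ : SubΓ → SubΓ → SubΓ
  (X ∩ Y) F = X F × Y F

  _∘_ : SubΓ → SubΓ → SubΓ
  (X ∘ Y) H = ∃ λ F → ∃ λ G → Y F × X G × R F G H

  _⇛_ : SubΓ → SubΓ → SubΓ
  (X ⇛ Y) H = ∀ F G → R F H G → X F → Y G

  D : Set (suc (suc a))
  D = Σ SubΓ Hereditary

  _≐_ : D → D → Set (suc a)
  X ≐ Y = (proj₁ X ⊆ proj₁ Y) × (proj₁ Y ⊆ proj₁ X)

  record Closed : Set (suc (suc a)) where
    field
      𝟏-her : Hereditary 𝟏
      ∪-her : ∀ X Y → Hereditary X → Hereditary Y → Hereditary (X ∪ Y)
      ∩-her : ∀ X Y → Hereditary X → Hereditary Y → Hereditary (X ∩ Y)
      ∘-her : ∀ X Y → Hereditary X → Hereditary Y → Hereditary (X ∘ Y)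
      ⇛-her : ∀ X Y → Hereditary X → Hereditary Y → Hereditary (X ⇛ Y)

  module Algebra (c : Closed) where
    open Closed c
    _⇛D_ _∪D_ _∩D_ _∘D_ : D → D → D
    (X , hX) ⇛D (Y , hY) = (X ⇛ Y) , ⇛-her X Y hX hY
    (X , hX) ∪D (Y , hY) = (X ∪ Y) , ∪-her X Y hX hY
    (X , hX) ∩D (Y , hY) = (X ∩ Y) , ∩-her X Y hX hY
    (X , hX) ∘D (Y , hY) = (X ∘ Y) , ∘-her X Y hX hY
    𝟏D : D
    𝟏D = 𝟏 , 𝟏-her

ExtraAxiom : {a : Level} → GirardSemilattice a → Set a
ExtraAxiom 𝐀 = ∀ x y → x ≤ ((x ⇒ y) ∧ one) ⇒ y
  where open GirardSemilattice 𝐀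

-- Union and intersection inherit the lattice laws from the predicates on Γ, and
-- X ∘ Y ⊆ Z ⇔ X ⊆ Y → Z holds for arbitrary sets of filters by unfolding R.
-- The content lies in the monoid ∘. The hypothesis makes 1 ≤ x → y imply x ≤ y,
-- hence x ≤ (x → y) → y, so R is symmetric in its first two arguments and ∘ is
-- commutative; associativity factors through the image filter
-- {b | ∃ x ∈ F. x → b ∈ G}; and the principal filter ↑1 shows that 𝟏 is a unit.
module Submission where

open import Defs
open import Level using (Level; lift; lower)
open import Data.Product using (Σ; ∃; _×_; _,_; proj₁; proj₂)
open import Data.Sum using (inj₁; inj₂)
open import Function using (_⇔_; mk⇔)
open import Function.Construct.Composition using (_⇔-∘_)
open import Function.Construct.Symmetry using (⇔-sym)
open import Relation.Binary.PropositionalEquality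
  using (_≡_; sym; trans; cong; subst; module ≡-Reasoning)
open import Algebra.Structures using (IsCommutativeMonoid)
open import Algebra.Structures.Biased using (isCommutativeMonoidˡ)
open import Algebra.Lattice.Structures using (IsLattice)
open import Algebra.Lattice.Morphism.Structures using (module LatticeMorphisms)
import Algebra.Lattice.Morphism.LatticeMonomorphism as LatticeMonomorphism
import Relation.Unary as U
open import Relation.Unary.Algebra using (∪-∩-isLattice)

module GirardProperties {a : Level} (𝐀 : GirardSemilattice a) where
  open GirardSemilattice 𝐀

  ≤-refl : ∀ {x} → x ≤ x
  ≤-refl {x} = ∧-idem x

  ≤-trans : ∀ {x y z} → x ≤ y → y ≤ z → x ≤ z
  ≤-trans {x} {y} {z} x≤y y≤z = begin
    x ∧ z        ≡⟨ cong (_∧ z) (sym x≤y) ⟩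
    (x ∧ y) ∧ z  ≡⟨ ∧-assoc x y z ⟩
    x ∧ (y ∧ z)  ≡⟨ cong (x ∧_) y≤z ⟩
    x ∧ y        ≡⟨ x≤y ⟩
    x            ∎
    where open ≡-Reasoning

  ∧-greatest : ∀ {x y z} → z ≤ x → z ≤ y → z ≤ x ∧ y
  ∧-greatest {x} {y} {z} z≤x z≤y = begin
    z ∧ (x ∧ y)  ≡⟨ sym (∧-assoc z x y) ⟩
    (z ∧ x) ∧ y  ≡⟨ cong (_∧ y) z≤x ⟩
    z ∧ y        ≡⟨ z≤y ⟩
    z            ∎
    where open ≡-Reasoning

  x∧y≤y : ∀ x y → x ∧ y ≤ y
  x∧y≤y x y = trans (∧-assoc x y y) (cong (x ∧_) (∧-idem y))

  x∧y≤x : ∀ x y → x ∧ y ≤ x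
  x∧y≤x x y = subst (_≤ x) (∧-comm y x) (x∧y≤y y x)

  ⇒-monoʳ-≤ : ∀ x {y z} → y ≤ z → x ⇒ y ≤ x ⇒ z
  ⇒-monoʳ-≤ x {y} {z} y≤z = trans (L3 x y z) (cong (x ⇒_) y≤z)

  ≤⇒one≤⇒ : ∀ {x y} → x ≤ y → one ≤ x ⇒ y
  ≤⇒one≤⇒ {x} x≤y = ≤-trans (L2 x) (⇒-monoʳ-≤ x x≤y)

  y≤x⇒[[x⇒one]⇒y] : ∀ x y → y ≤ x ⇒ ((x ⇒ one) ⇒ y)
  y≤x⇒[[x⇒one]⇒y] x y =
    ≤-trans (subst (_≤ (x ⇒ one) ⇒ (x ⇒ y)) (L1 y) (L4 one y x)) (L5 (x ⇒ one) x y)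

  -- The hypothesis ExtraAxiom enters the construction only through this consequence.
  HasResidualOrder : Set a
  HasResidualOrder = ∀ {x y} → one ≤ x ⇒ y → x ≤ y

  extraAxiom⇒hasResidualOrder : ExtraAxiom 𝐀 → HasResidualOrder
  extraAxiom⇒hasResidualOrder ext {x} {y} one≤x⇒y =
    subst (x ≤_) (L1 y) (subst (λ t → x ≤ t ⇒ y) [x⇒y]∧one≡one (ext x y))
    where
    [x⇒y]∧one≡one : (x ⇒ y) ∧ one ≡ one
    [x⇒y]∧one≡one = trans (∧-comm (x ⇒ y) one) one≤x⇒y

  module _ (one≤⇒⇒≤ : HasResidualOrder) where

    ⇒-suffixing : ∀ x y z → x ⇒ y ≤ (y ⇒ z) ⇒ (x ⇒ z)
    ⇒-suffixing x y z =
      one≤⇒⇒≤ (≤-trans (≤⇒one≤⇒ (L4 y z x)) (L5 (y ⇒ z) (x ⇒ y) (x ⇒ z)))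

    ⇒-antitoneˡ-≤ : ∀ {x y} z → x ≤ y → y ⇒ z ≤ x ⇒ z
    ⇒-antitoneˡ-≤ {x} {y} z x≤y = one≤⇒⇒≤ (≤-trans (≤⇒one≤⇒ x≤y) (⇒-suffixing x y z))

    x≤[x⇒y]⇒y : ∀ x y → x ≤ (x ⇒ y) ⇒ y
    x≤[x⇒y]⇒y x y = one≤⇒⇒≤ (≤-trans (L2 (x ⇒ y)) (L5 (x ⇒ y) x y))

module DProperties {a : Level} (𝐀 : GirardSemilattice a) where
  open GirardSemilattice 𝐀
  open GirardProperties 𝐀
  open Construction 𝐀

  closed : Closed
  closed = record
    { 𝟏-her = λ F G 𝟏F F⊆G → lift (F⊆G one (lower 𝟏F))
    ; ∪-her = λ where
        X Y hX hY F G (inj₁ XF) F⊆G → inj₁ (hX F G XF F⊆G)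
        X Y hX hY F G (inj₂ YF) F⊆G → inj₂ (hY F G YF F⊆G)
    ; ∩-her = λ X Y hX hY F G (XF , YF) F⊆G → hX F G XF F⊆G , hY F G YF F⊆G
    ; ∘-her = λ X Y hX hY H H′ (F , G , YF , XG , r) H⊆H′ →
        F , G , YF , XG , λ x y Fx Gx⇒y → H⊆H′ y (r x y Fx Gx⇒y)
    ; ⇛-her = λ X Y hX hY H H′ X⇛YH H⊆H′ F G r XF →
        X⇛YH F G (λ x y Fx H′x⇒y → r x y Fx (H⊆H′ (x ⇒ y) H′x⇒y)) XF
    }

  open Algebra closed

  ∘-⊆⇔⊆-⇛ : ∀ X Y Z → ((X ∘ Y) ⊆ Z) ⇔ (X ⊆ (Y ⇛ Z))
  ∘-⊆⇔⊆-⇛ X Y Z = mk⇔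
    (λ X∘Y⊆Z H XH F G r YF → X∘Y⊆Z G (F , H , YF , XH , r))
    (λ X⊆Y⇛Z H (F , G , YF , XG , r) → X⊆Y⇛Z G XG F H r YF)

  ∘-mono-⊆ : ∀ {X X′ Y Y′} → X ⊆ X′ → Y ⊆ Y′ → (X ∘ Y) ⊆ (X′ ∘ Y′)
  ∘-mono-⊆ X⊆X′ Y⊆Y′ H (F , G , YF , XG , r) = F , G , Y⊆Y′ F YF , X⊆X′ G XG , r

  ⇛-mono-⊆ : ∀ {X X′ Y Y′} → X′ ⊆ X → Y ⊆ Y′ → (X ⇛ Y) ⊆ (X′ ⇛ Y′)
  ⇛-mono-⊆ X′⊆X Y⊆Y′ H X⇛YH F G r X′F = Y⊆Y′ G (X⇛YH F G r (X′⊆X F X′F))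

  ∩-≐⇔⊆ : ∀ (X Y : D) → ((X ∩D Y) ≐ X) ⇔ (proj₁ X ⊆ proj₁ Y)
  ∩-≐⇔⊆ X Y = mk⇔ (λ (_ , X⊆X∩Y) F XF → proj₂ (X⊆X∩Y F XF))
                   (λ X⊆Y → (λ F → proj₁) , λ F XF → XF , X⊆Y F XF)

  ∘-cong : ∀ {X X′ Y Y′} → X ≐ X′ → Y ≐ Y′ → (X ∘D Y) ≐ (X′ ∘D Y′)
  ∘-cong (X⊆X′ , X′⊆X) (Y⊆Y′ , Y′⊆Y) = ∘-mono-⊆ X⊆X′ Y⊆Y′ , ∘-mono-⊆ X′⊆X Y′⊆Y

  ⇛-cong : ∀ {X X′ Y Y′} → X ≐ X′ → Y ≐ Y′ → (X ⇛D Y) ≐ (X′ ⇛D Y′)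
  ⇛-cong (X⊆X′ , X′⊆X) (Y⊆Y′ , Y′⊆Y) = ⇛-mono-⊆ X′⊆X Y⊆Y′ , ⇛-mono-⊆ X⊆X′ Y′⊆Y

  proj₁-isLatticeMonomorphism :
    LatticeMorphisms.IsLatticeMonomorphism
      (record { _≈_ = _≐_ ; _∧_ = _∩D_ ; _∨_ = _∪D_ })
      (record { _≈_ = U._≐_ ; _∧_ = U._∩_ ; _∨_ = U._∪_ })
      proj₁
  proj₁-isLatticeMonomorphism = record
    { isLatticeHomomorphism = record
      { isRelHomomorphism = record
        { cong = λ (X⊆Y , Y⊆X) → (λ {F} → X⊆Y F) , (λ {F} → Y⊆X F) }
      ; ∧-homo = λ _ _ → (λ z → z) , (λ z → z)
      ; ∨-homo = λ _ _ → (λ z → z) , (λ z → z)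
      }
    ; injective = λ (X⊆Y , Y⊆X) → (λ F → X⊆Y {F}) , (λ F → Y⊆X {F})
    }

  ∪-∩-isLatticeD : IsLattice _≐_ _∪D_ _∩D_
  ∪-∩-isLatticeD = LatticeMonomorphism.isLattice proj₁-isLatticeMonomorphism
    (∪-∩-isLattice Γ _)

  module _ (one≤⇒⇒≤ : HasResidualOrder) where

    ↑one : Γ
    ↑one = (one ≤_) , record
      { nonempty = one , ≤-refl
      ; upclosed = ≤-trans
      ; ∧-closed = ∧-greatest
      }

    -- The least filter H with R F G H.
    image : Γ → Γ → Γ
    image (F , isF) (G , isG) = (λ b → ∃ λ x → F x × G (x ⇒ b)) , record
      { nonempty =
          let (x , Fx) = IsFilter.nonempty isF ; (u , Gu) = IsFilter.nonempty isG
          in (x ⇒ one) ⇒ u , x , Fx , IsFilter.upclosed isG Gu (y≤x⇒[[x⇒one]⇒y] x u)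
      ; upclosed = λ (x , Fx , Gx⇒b) b≤c →
          x , Fx , IsFilter.upclosed isG Gx⇒b (⇒-monoʳ-≤ x b≤c)
      ; ∧-closed = λ {b₁} {b₂} (x₁ , Fx₁ , Gx₁⇒b₁) (x₂ , Fx₂ , Gx₂⇒b₂) →
          x₁ ∧ x₂ , IsFilter.∧-closed isF Fx₁ Fx₂ ,
          subst G (L3 (x₁ ∧ x₂) b₁ b₂) (IsFilter.∧-closed isG
            (IsFilter.upclosed isG Gx₁⇒b₁ (⇒-antitoneˡ-≤ one≤⇒⇒≤ b₁ (x∧y≤x x₁ x₂)))
            (IsFilter.upclosed isG Gx₂⇒b₂ (⇒-antitoneˡ-≤ one≤⇒⇒≤ b₂ (x∧y≤y x₁ x₂))))
      }

    R-image : ∀ F G → R F G (image F G)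
    R-image F G x y Fx Gx⇒y = x , Fx , Gx⇒y

    R-comm : ∀ {F G H} → R F G H → R G F H
    R-comm {G = G} r x y Gx Fx⇒y =
      r (x ⇒ y) y Fx⇒y (IsFilter.upclosed (proj₂ G) Gx (x≤[x⇒y]⇒y one≤⇒⇒≤ x y))

    ∘-comm-⊆ : ∀ X Y → (X ∘ Y) ⊆ (Y ∘ X)
    ∘-comm-⊆ X Y H (F , G , YF , XG , r) = G , F , XG , YF , R-comm {F} {G} {H} r

    ∘-assocˡ-⊆ : ∀ X Y Z → ((X ∘ Y) ∘ Z) ⊆ (X ∘ (Y ∘ Z))
    ∘-assocˡ-⊆ X Y Z H (F , G , ZF , (F′ , G′ , YF′ , XG′ , r′) , r) =
      image F F′ , G′ , (F , F′ , ZF , YF′ , R-image F F′) , XG′ ,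
      λ { b c (x , Fx , F′x⇒b) G′b⇒c →
          r x c Fx (r′ (x ⇒ b) (x ⇒ c) F′x⇒b
            (IsFilter.upclosed (proj₂ G′) G′b⇒c (L4 b c x))) }

    ∘-assocʳ-⊆ : ∀ X Y Z → (X ∘ (Y ∘ Z)) ⊆ ((X ∘ Y) ∘ Z)
    ∘-assocʳ-⊆ X Y Z H X∘[Y∘Z]H =
      ∘-comm-⊆ Z (X ∘ Y) H (∘-assocˡ-⊆ Z X Y H (∘-comm-⊆ Y (Z ∘ X) H
        (∘-assocˡ-⊆ Y Z X H (∘-comm-⊆ X (Y ∘ Z) H X∘[Y∘Z]H))))

    ∘-identityˡ : ∀ X → (𝟏D ∘D X) ≐ X
    ∘-identityˡ (X , hX) =
      (λ H (F , G , XF , lift Gone , r) → hX F H XF λ x Fx →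
         r x x Fx (IsFilter.upclosed (proj₂ G) Gone (L2 x))) ,
      (λ H XH → H , ↑one , XH , lift ≤-refl , λ x y Hx one≤x⇒y →
         IsFilter.upclosed (proj₂ H) Hx (one≤⇒⇒≤ one≤x⇒y))

    ∘-isCommutativeMonoid : IsCommutativeMonoid _≐_ _∘D_ 𝟏D
    ∘-isCommutativeMonoid = isCommutativeMonoidˡ record
      { isSemigroup = record
        { isMagma = record
          { isEquivalence = IsLattice.isEquivalence ∪-∩-isLatticeD
          ; ∙-cong = λ {X X′ Y Y′} → ∘-cong {X} {X′} {Y} {Y′}
          }
        ; assoc = λ (X , _) (Y , _) (Z , _) → ∘-assocˡ-⊆ X Y Z , ∘-assocʳ-⊆ X Y Z
        }
      ; identityˡ = ∘-identityˡ
      ; comm = λ (X , _) (Y , _) → ∘-comm-⊆ X Y , ∘-comm-⊆ Y X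
      }

    isCommResLattice : IsCommResLattice _≐_ _⇛D_ _∪D_ _∩D_ _∘D_ 𝟏D
    isCommResLattice = record
      { isLattice = ∪-∩-isLatticeD
      ; isCommutativeMonoid = ∘-isCommutativeMonoid
      ; ⇒-cong = λ {X X′ Y Y′} → ⇛-cong {X} {X′} {Y} {Y′}
      ; residuated = λ X Y Z →
          ⇔-sym (∩-≐⇔⊆ X (Y ⇛D Z))
            ⇔-∘ (∘-⊆⇔⊆-⇛ (proj₁ X) (proj₁ Y) (proj₁ Z) ⇔-∘ ∩-≐⇔⊆ (X ∘D Y) Z)
      }

mainTheorem6 : {a : Level} (𝐀 : GirardSemilattice a) → ExtraAxiom 𝐀 → Σ (Construction.Closed 𝐀) (λ c → IsCommResLattice (Construction._≐_ 𝐀) (Construction.Algebra._⇛D_ 𝐀 c) (Construction.Algebra._∪D_ 𝐀 c) (Construction.Algebra._∩D_ 𝐀 c) (Construction.Algebra._∘D_ 𝐀 c) (Construction.Algebra.𝟏D 𝐀 c))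
mainTheorem6 𝐀 ext =
  closed , isCommResLattice (extraAxiom⇒hasResidualOrder ext)
  where
  open GirardProperties 𝐀
  open DProperties 𝐀
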